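{- Let $d$ be a positive integer, $V=\{x_1,\dots,x_n\}$, $V'=\{x_1',\dots,x_n'\}$, $X = V\cup V'$, and fix a well-ordered monomial ordering on monomials in $X$. Let $\boldsymbol\lambda = (\lambda_q)_{q\in M}$ be parameters indexed by a finite set $M$ of monomials in $V$, let $\mathcal{L} = \mathbb{Z}_{2^d}[\boldsymbol\lambda]$, let $\eta = \sum_{q\in M}\lambda_q\, q \in \mathcal{L}[V]$ and $\eta' = \eta[x_1'/x_1,\dots,x_n'/x_n]$. Let $F_\rho$ be a finite subset of $\mathbb{Z}_{2^d}[X]$ and let $G$ be a strong Gröbner basis of the ideal $\langle F_\rho\rangle \subseteq \mathbb{Z}_{2^d}[X]$. Let $\mathrm{PNF}$ be any parametric normal form. Then for every $\mu \in \mathbb{Z}_{2^d}$ and every concrete assignment $\overline{\boldsymbol\lambda} \in \mathbb{Z}_{2^d}^{M}$ of values to $\boldsymbol\lambda$: if $\mathrm{PNF}(\eta' - \mu\cdot\eta \mid G)$ becomes $0$ after substituting $\overline{\boldsymbol\lambda}$ for $\boldsymbol\lambda$, then $\mathrm{NF}\big((\eta' - \mu\cdot\eta)[\overline{\boldsymbol\lambda}/\boldsymbol\lambda] \mid G\big) = 0$.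
   Context: $\mathbb{Z}_{2^d}$ is the ring of integers modulo $2^d$; for nonzero $a$, $\nu_2(a)$ is the largest $k$ with $2^k \mid a$. Monomials, terms, well-ordered monomial ordering ($1 \prec$ every nonconstant monomial, and $p\prec q \Rightarrow pr \prec qr$), $\mathrm{lm}$, $\mathrm{lc}$, $\mathrm{lt}$ (leading monomial, coefficient, term) are as usual; for polynomials in $\mathcal{L}[X]$ the coefficients lie in $\mathcal{L}$. Strong reduction: $f \twoheadrightarrow_G h$ if $h = f - t g$ for some term $t$ and $g\in G$ with $\mathrm{lt}(f) = t\,\mathrm{lt}(g)$; a strong Gröbner basis of an ideal $I$ is a finite $G\subseteq I$ such that $f\in I$ iff $f$ reduces to $0$ by a finite chain of strong reductions. Parametric normal form: a map $\mathrm{PNF}$ sending $f \in \mathcal{L}[X]$ and a finite $G\subseteq \mathbb{Z}_{2^d}[X]$ to $\mathrm{PNF}(f\mid G)\in\mathcal{L}[X]$ such that (1) $\mathrm{PNF}(0\mid G) = 0$; (2) if $\mathrm{PNF}(f\mid G)\neq 0$ then $\mathrm{lt}(\mathrm{PNF}(f\mid G)) \notin \langle \mathrm{lt}(g)\rangle_{\mathcal{L}[X]}$ for every $g\in G$; (3) $f - \mathrm{PNF}(f\mid G)$ lies in the ideal of $\mathcal{L}[X]$ generated by $G$. Normal form $\mathrm{NF}(f\mid G)$ for $f\in\mathbb{Z}_{2^d}[X]$: repeatedly, while there exist $g\in G$ and a term $t = c_t m_t$ of $f$ with $\nu_2(\mathrm{lc}(g)) \le \nu_2(c_t)$ and $\mathrm{lm}(g)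 \mid m_t$, replace $f$ by $f - \frac{t}{\mathrm{lt}(g)}\, g$, where $\frac{t}{\mathrm{lt}(g)} = \frac{c_t}{\mathrm{lc}(g)}\cdot\frac{m_t}{\mathrm{lm}(g)}$ and for $a = 2^{\nu_2(a)}s_a$, $b = 2^{\nu_2(b)}s_b$ ($s_a,s_b$ odd) $\frac{a}{b} := 2^{\nu_2(a)-\nu_2(b)} s_a s_b^{ -1}$ with $s_b^{ -1}$ the inverse of $s_b$ in $\mathbb{Z}_{2^d}$; $\mathrm{NF}(f\mid G)$ is the polynomial obtained when no such $g,t$ exist. -}

module Defs where

open import Level using (0ℓ)
open import Data.Nat as ℕ using (ℕ; zero; suc; _≤_)
open import Data.Integer as ℤ using (ℤ; +_)
import Data.Integer.Divisibility as ℤDiv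
open import Data.Fin using (Fin)
open import Data.Vec as Vec using (Vec; _++_; replicate; zipWith; tabulate; toList; lookup; _[_]≔_)
open import Data.Vec.Properties using (≡-dec)
open import Data.List as List using (List; []; _∷_; map; foldr; concatMap)
open import Data.List.Membership.Propositional using (_∈_)
open import Data.List.Relation.Unary.All using (All)
open import Data.Product using (Σ; ∃; ∃-syntax; _×_; _,_; proj₁; proj₂)
open import Data.Sum using (_⊎_)
open import Relation.Nullary using (¬_; yes; no)
open import Relation.Binary.PropositionalEquality using (_≡_)
open import Relation.Binary.Construct.Closure.ReflexiveTransitive using (Star)
open import Relation.Binary.Structures using (IsStrictTotalOrder)
open import Relation.Binary.Core using (Rel)
open import Induction.WellFounded using (WellFounded)
open import Function.Bundles using (_⇔_)
open import Algebra.Bundles.Raw using (RawRing)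

Mon : ℕ → Set
Mon k = Vec ℕ k

one : ∀ {k} → Mon k
one = replicate _ 0

_·ₘ_ : ∀ {k} → Mon k → Mon k → Mon k
_·ₘ_ = zipWith ℕ._+_

_∣ₘ_ : ∀ {k} → Mon k → Mon k → Set
m ∣ₘ m' = ∃[ r ] m' ≡ r ·ₘ m

record IsMonomialOrder {k : ℕ} (_≺_ : Rel (Mon k) 0ℓ) : Set where
  field
    strictTotal    : IsStrictTotalOrder _≡_ _≺_
    wellFounded    : WellFounded _≺_
    one-least      : ∀ m → ¬ (m ≡ one) → one ≺ m
    multiplicative : ∀ p q r → p ≺ q → (p ·ₘ r) ≺ (q ·ₘ r)

Zmod : ℕ → RawRing 0ℓ 0ℓ
Zmod d = record
  { Carrier = ℤ
  ; _≈_ = λ a b → (+ (2 ℕ.^ d)) ℤDiv.∣ (a ℤ.- b)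
  ; _+_ = ℤ._+_
  ; _*_ = ℤ._*_
  ; -_ = ℤ.-_
  ; 0# = + 0
  ; 1# = + 1
  }

-- Polynomials in k variables over a (raw) commutative ring R, as formal
-- finite sums of terms (coefficient, monomial); equality is coefficientwise.

module PolyOver (R : RawRing 0ℓ 0ℓ) (k : ℕ) where
  open RawRing R

  Poly : Set
  Poly = List (Carrier × Mon k)

  coeff : Poly → Mon k → Carrier
  coeff [] m = 0#
  coeff ((a , m') ∷ p) m with ≡-dec ℕ._≟_ m' m
  ... | yes _ = a + coeff p m
  ... | no  _ = coeff p m

  _≈ₚ_ : Poly → Poly → Set
  p ≈ₚ q = ∀ m → coeff p m ≈ coeff q m

  0ₚ : Poly
  0ₚ = []

  term : Carrier → Mon k → Poly
  term a m = (a , m) ∷ []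

  _+ₚ_ : Poly → Poly → Poly
  p +ₚ q = p List.++ q

  -ₚ_ : Poly → Poly
  -ₚ p = map (λ t → (- proj₁ t , proj₂ t)) p

  _-ₚ_ : Poly → Poly → Poly
  p -ₚ q = p +ₚ (-ₚ q)

  _*ₚ_ : Poly → Poly → Poly
  p *ₚ q = concatMap (λ s → map (λ t → (proj₁ s * proj₁ t , proj₂ s ·ₘ proj₂ t)) q) p

  sumₚ : List Poly → Poly
  sumₚ = foldr _+ₚ_ 0ₚ

  InIdeal : List Poly → Poly → Set
  InIdeal F f = ∃[ hs ] All (λ hg → proj₂ hg ∈ F) hs
                 × (f ≈ₚ sumₚ (map (λ hg → proj₁ hg *ₚ proj₂ hg) hs))

  module Ordered (_≺_ : Rel (Mon k) 0ℓ) where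
    IsLM : Poly → Mon k → Set
    IsLM p m = ¬ (coeff p m ≈ 0#)
             × (∀ m' → ¬ (coeff p m' ≈ 0#) → m' ≡ m ⊎ m' ≺ m)

    IsLT : Poly → Carrier → Mon k → Set
    IsLT p a m = IsLM p m × (a ≈ coeff p m)

module Setting (d n m : ℕ) where

  ZR : RawRing 0ℓ 0ℓ
  ZR = Zmod d

  open RawRing ZR using () renaming (_≈_ to _≈ᶻ_; _*_ to _*ᶻ_)

  module L = PolyOver ZR m

  LR : RawRing 0ℓ 0ℓ
  LR = record
    { Carrier = L.Poly ; _≈_ = L._≈ₚ_ ; _+_ = L._+ₚ_ ; _*_ = L._*ₚ_
    ; -_ = L.-ₚ_ ; 0# = L.0ₚ ; 1# = L.term (+ 1) one }

  -- ℤ_{2^d}[X] and 𝓛[X], X = V ∪ V' (first n variables V, last n V')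
  module ZX = PolyOver ZR (n ℕ.+ n)
  module LX = PolyOver LR (n ℕ.+ n)

  constL : ℤ → L.Poly
  constL a = L.term a one

  embed : ZX.Poly → LX.Poly
  embed = map (λ t → (constL (proj₁ t) , proj₂ t))

  _^ᶻ_ : ℤ → ℕ → ℤ
  _^ᶻ_ = ℤ._^_

  evalMon : Vec ℤ m → Mon m → ℤ
  evalMon v e = foldr ℤ._*_ (+ 1) (toList (zipWith _^ᶻ_ v e))

  evalL : Vec ℤ m → L.Poly → ℤ
  evalL v p = foldr ℤ._+_ (+ 0) (map (λ t → proj₁ t ℤ.* evalMon v (proj₂ t)) p)

  substλ : Vec ℤ m → LX.Poly → ZX.Poly
  substλ v = map (λ t → (evalL v (proj₁ t) , proj₂ t))

  param : Fin m → L.Poly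
  param i = L.term (+ 1) (replicate m 0 [ i ]≔ 1)

  -- η = Σ_{q ∈ M} λ_q q  and  η' = η[x'/x],  M = {qs_1,…,qs_m}
  η : Vec (Mon n) m → LX.Poly
  η qs = toList (tabulate (λ i → (param i , lookup qs i ++ replicate n 0)))

  η′ : Vec (Mon n) m → LX.Poly
  η′ qs = toList (tabulate (λ i → (param i , replicate n 0 ++ lookup qs i)))

  module WithOrder (_≺_ : Rel (Mon (n ℕ.+ n)) 0ℓ) where
    open ZX.Ordered _≺_ renaming (IsLT to IsLTᶻ)
    open LX.Ordered _≺_ renaming (IsLT to IsLTᴸ)

    Divides2^ : ℕ → ℤ → Set
    Divides2^ j a = ∃[ b ] a ≈ᶻ ((+ (2 ℕ.^ j)) *ᶻ b)

    IsVal : ℤ → ℕ → Set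
    IsVal a j = ¬ (a ≈ᶻ + 0) × Divides2^ j a × (∀ j' → Divides2^ j' a → j' ≤ j)

    Odd : ℤ → Set
    Odd s = ¬ ((+ 2) ℤDiv.∣ s)

    IsQuot : ℤ → ℤ → ℤ → Set
    IsQuot a b q = ∃[ va ] ∃[ vb ] ∃[ sa ] ∃[ sb ] ∃[ sb⁻¹ ]
        IsVal a va × IsVal b vb
      × a ≈ᶻ ((+ (2 ℕ.^ va)) *ᶻ sa) × Odd sa
      × b ≈ᶻ ((+ (2 ℕ.^ vb)) *ᶻ sb) × Odd sb
      × (sb *ᶻ sb⁻¹) ≈ᶻ + 1
      × q ≡ ((+ (2 ℕ.^ (va ℕ.∸ vb))) *ᶻ sa) *ᶻ sb⁻¹

    NFStep : List ZX.Poly → ZX.Poly → ZX.Poly → Set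
    NFStep G f f′ = ∃[ g ] ∃[ mt ] ∃[ lcg ] ∃[ lmg ] ∃[ vt ] ∃[ vg ] ∃[ r ] ∃[ q ]
        g ∈ G
      × IsLTᶻ g lcg lmg
      × IsVal (ZX.coeff f mt) vt × IsVal lcg vg × vg ≤ vt
      × mt ≡ r ·ₘ lmg
      × IsQuot (ZX.coeff f mt) lcg q
      × (f′ ZX.≈ₚ (f ZX.-ₚ (ZX.term q r ZX.*ₚ g)))

    NFReducible : List ZX.Poly → ZX.Poly → Set
    NFReducible G f = ∃[ g ] ∃[ mt ] ∃[ lcg ] ∃[ lmg ] ∃[ vt ] ∃[ vg ]
        g ∈ G
      × IsLTᶻ g lcg lmg
      × IsVal (ZX.coeff f mt) vt × IsVal lcg vg × vg ≤ vt
      × lmg ∣ₘ mt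

    IsNF : List ZX.Poly → ZX.Poly → ZX.Poly → Set
    IsNF G f h = Star (NFStep G) f h × ¬ NFReducible G h

    StrongRed : List ZX.Poly → ZX.Poly → ZX.Poly → Set
    StrongRed G f h = ∃[ g ] ∃[ c ] ∃[ r ] ∃[ lcf ] ∃[ lmf ] ∃[ lcg ] ∃[ lmg ]
        g ∈ G
      × IsLTᶻ f lcf lmf × IsLTᶻ g lcg lmg
      × lmf ≡ r ·ₘ lmg × lcf ≈ᶻ (c *ᶻ lcg)
      × (h ZX.≈ₚ (f ZX.-ₚ (ZX.term c r ZX.*ₚ g)))

    ReducesToZero : List ZX.Poly → ZX.Poly → Set
    ReducesToZero G f = ∃[ h ] Star (StrongRed G) f h × (h ZX.≈ₚ ZX.0ₚ)

    IsStrongGB : List ZX.Poly → List ZX.Poly → Set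
    IsStrongGB F G = All (ZX.InIdeal F) G
                   × (∀ f → ZX.InIdeal F f ⇔ ReducesToZero G f)

    record IsPNF (PNF : LX.Poly → List ZX.Poly → LX.Poly) : Set where
      field
        pnf-zero  : ∀ f G → f LX.≈ₚ LX.0ₚ → PNF f G LX.≈ₚ LX.0ₚ
        pnf-lt    : ∀ f G a mo → IsLTᴸ (PNF f G) a mo →
                    ∀ g → g ∈ G → ∀ lcg lmg → IsLTᶻ g lcg lmg →
                    ¬ LX.InIdeal (LX.term (constL lcg) lmg ∷ []) (LX.term a mo)
        pnf-ideal : ∀ f G → LX.InIdeal (map embed G) (f LX.-ₚ PNF f G)

{-# OPTIONS --safe #-}
module Submission where

open import Defs
open import Level using (0ℓ)
open import Data.Nat using (ℕ; _≤_)
open import Data.Integer using (ℤ)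
open import Data.Vec using (Vec; lookup)
open import Data.List using (List)
open import Relation.Binary.Core using (Rel)
open import Relation.Binary.PropositionalEquality using (_≡_)
open import Algebra.Bundles.Raw using (RawRing)

open import Data.Nat using (zero; suc)
import Data.Nat as ℕ
import Data.Nat.Properties as ℕ
import Data.Nat.Divisibility as ℕ
open import Data.Nat.Induction using (<-wellFounded)
open import Data.Integer as ℤ using (+_; _+_; _*_; -_; _-_)
import Data.Integer.Properties as ℤ
import Data.Integer.Divisibility as Unsigned
open import Data.Integer.Divisibility.Signed
  using (_∣_; _∣?_; divides; ∣-refl; ∣-trans; ∣ᵤ⇒∣; ∣⇒∣ᵤ; ∣m∣n⇒∣m+n; ∣m⇒∣-m; ∣n⇒∣m*n; ∣m⇒∣m*n)
open import Data.Integer.Tactic.RingSolver using (solve-∀)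
open import Data.Vec.Properties using (≡-dec; zipWith-assoc; zipWith-identityˡ; zipWith-identityʳ)
open import Data.List using ([]; _∷_; _++_; map; foldr; filter; length; concat)
open import Data.List.Properties
  using (map-++; map-∘; map-cong; map-id; ++-identityʳ; concat-++; length-filter)
open import Data.List.Membership.Propositional using (_∈_)
open import Data.List.Membership.Propositional.Properties using (∈-map⁻)
open import Data.List.Relation.Unary.All as All using (All; []; _∷_)
import Data.List.Relation.Unary.All.Properties as All
open import Data.Product using (∃; ∃-syntax; _×_; _,_; proj₁; proj₂; map₁; map₂)
import Data.Product as Product
open import Function using (_∘_; id)
open import Function.Bundles using (Equivalence)
open import Induction.WellFounded using (Acc; acc)
open import Relation.Binary.Bundles using (Setoid)
open import Relation.Binary.Construct.Closure.ReflexiveTransitive using (Star; ε; _◅_; fold)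
open import Relation.Binary.PropositionalEquality using (_≢_; refl; sym; trans; cong; cong₂; subst)
import Relation.Binary.Reasoning.Setoid as SetoidReasoning
open import Relation.Nullary using (¬_; Dec; yes; no; ¬?; contradiction)
open import Relation.Nullary.Decidable using (map′)

-- Substituting λ̄ for λ is a ring homomorphism 𝓛[X] → ℤ_{2^d}[X] that fixes ℤ_{2^d}[X]. Applied
-- to the defining property  f − PNF(f | G) ∈ ⟨G⟩  of a parametric normal form it gives
-- f̄ − 0 ∈ ⟨G⟩, so f̄ ∈ ⟨G⟩ = ⟨F_ρ⟩. Every NF step subtracts a multiple of an element of G, so an
-- NF-result h of f̄ lies in ⟨F_ρ⟩ too, and as G is a strong Gröbner basis, h strongly reduces
-- to 0. A first step of that reduction would have lc(h) = c · lc(g), hence ν₂(lc g) ≤ ν₂(lc h),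
-- so it would also be an NF step; h is NF-irreducible, so there is no step and h = 0 already.

private variable
  k : ℕ

greatest : ∀ {P : ℕ → Set} k → (∀ {j} → j ℕ.< k → Dec (P j)) → (∀ {j} → P j → j ℕ.< k) →
           P 0 → ∃[ j ] P j × (∀ j′ → P j′ → j′ ≤ j)
greatest         zero    P? bounded P0 = contradiction (bounded P0) λ ()
greatest {P = P} (suc k) P? bounded P0 with P? (ℕ.n<1+n k)
... | yes Pk = k , Pk , λ j′ Pj′ → ℕ.s≤s⁻¹ (bounded Pj′)
... | no ¬Pk = greatest k (P? ∘ ℕ.m<n⇒m<1+n) bounded′ P0
  where
    bounded′ : ∀ {j} → P j → j ℕ.< k
    bounded′ Pj = ℕ.≤∧≢⇒< (ℕ.s≤s⁻¹ (bounded Pj)) λ { refl → ¬Pk Pj }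

^-monoʳ-∣ : ∀ b {i j} → i ≤ j → b ℕ.^ i ℕ.∣ b ℕ.^ j
^-monoʳ-∣ b {i} {j} i≤j = subst (b ℕ.^ i ℕ.∣_) bⁱbʲ⁻ⁱ≡bʲ (ℕ.m∣m*n (b ℕ.^ (j ℕ.∸ i)))
  where
    bⁱbʲ⁻ⁱ≡bʲ : b ℕ.^ i ℕ.* b ℕ.^ (j ℕ.∸ i) ≡ b ℕ.^ j
    bⁱbʲ⁻ⁱ≡bʲ = trans (sym (ℕ.^-distribˡ-+-* b i (j ℕ.∸ i))) (cong (b ℕ.^_) (ℕ.m+[n∸m]≡n i≤j))

infix 4 _≟ₘ_
_≟ₘ_ : (x y : Mon k) → Dec (x ≡ y)
_≟ₘ_ = ≡-dec ℕ._≟_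

·ₘ-assoc : (x y z : Mon k) → (x ·ₘ y) ·ₘ z ≡ x ·ₘ (y ·ₘ z)
·ₘ-assoc = zipWith-assoc ℕ.+-assoc

·ₘ-identityˡ : (x : Mon k) → one ·ₘ x ≡ x
·ₘ-identityˡ = zipWith-identityˡ ℕ.+-identityˡ

·ₘ-identityʳ : (x : Mon k) → x ·ₘ one ≡ x
·ₘ-identityʳ = zipWith-identityʳ ℕ.+-identityʳ

module Congruence (N : ℕ) where

  -- The equality of Zmod, wrapped in a record (as are _≋ₚ_ and _∈⟨_⟩ below) so that Agda can
  -- infer its arguments by unification.
  infix 4 _≋_
  record _≋_ (a b : ℤ) : Set where
    constructor ∣⇒≋
    field ≋⇒∣ : + N Unsigned.∣ (a - b)
  open _≋_ public

  private variable
    a b c e : ℤ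

  private
    ≋-by : ∀ {x} → + N ∣ x → x ≡ a - b → a ≋ b
    ≋-by N∣x refl = ∣⇒≋ (∣⇒∣ᵤ N∣x)

    ∣-diff : a ≋ b → + N ∣ (a - b)
    ∣-diff = ∣ᵤ⇒∣ ∘ ≋⇒∣

  ≋-refl : a ≋ a
  ≋-refl {a} = ≋-by (divides (+ 0) refl) (sym (ℤ.+-inverseʳ a))

  ≋-reflexive : a ≡ b → a ≋ b
  ≋-reflexive refl = ≋-refl

  ≋-sym : a ≋ b → b ≋ a
  ≋-sym {a} {b} a≋b = ≋-by (∣m⇒∣-m (∣-diff a≋b)) (identity a b)
    where identity : ∀ a b → - (a - b) ≡ b - a
          identity = solve-∀

  ≋-trans : a ≋ b → b ≋ c → a ≋ c
  ≋-trans {a} {b} {c} a≋b b≋c = ≋-by (∣m∣n⇒∣m+n (∣-diff a≋b) (∣-diff b≋c)) (identity a b c)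
    where identity : ∀ a b c → (a - b) + (b - c) ≡ a - c
          identity = solve-∀

  ≋-setoid : Setoid 0ℓ 0ℓ
  ≋-setoid = record
    { Carrier = ℤ ; _≈_ = _≋_
    ; isEquivalence = record { refl = ≋-refl ; sym = ≋-sym ; trans = ≋-trans } }

  module ≋-Reasoning = SetoidReasoning ≋-setoid

  +-cong : a ≋ b → c ≋ e → a + c ≋ b + e
  +-cong {a} {b} {c} {e} a≋b c≋e =
    ≋-by (∣m∣n⇒∣m+n (∣-diff a≋b) (∣-diff c≋e)) (identity a b c e)
    where identity : ∀ a b c e → (a - b) + (c - e) ≡ (a + c) - (b + e)
          identity = solve-∀

  *-cong : a ≋ b → c ≋ e → a * c ≋ b * e
  *-cong {a} {b} {c} {e} a≋b c≋e =
    ≋-by (∣m∣n⇒∣m+n (∣m⇒∣m*n c (∣-diff a≋b)) (∣n⇒∣m*n b (∣-diff c≋e))) (identity a b c e)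
    where identity : ∀ a b c e → (a - b) * c + b * (c - e) ≡ a * c - b * e
          identity = solve-∀

  -‿cong : a ≋ b → - a ≋ - b
  -‿cong {a} {b} a≋b = ≋-by (∣m⇒∣-m (∣-diff a≋b)) (identity a b)
    where identity : ∀ a b → - (a - b) ≡ - a - - b
          identity = solve-∀

  ≋⇒-≋0 : a ≋ b → a - b ≋ + 0
  ≋⇒-≋0 {a} {b} a≋b = ≋-by (∣-diff a≋b) (sym (ℤ.+-identityʳ (a - b)))

  -≋0⇒≋ : a - b ≋ + 0 → a ≋ b
  -≋0⇒≋ {a} {b} a-b≋0 = ≋-by (∣-diff a-b≋0) (ℤ.+-identityʳ (a - b))

  ∣⇒≋0 : + N ∣ a → a ≋ + 0
  ∣⇒≋0 {a} N∣a = ≋-by N∣a (sym (ℤ.+-identityʳ a))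

  ∣-resp-≋ : ∀ {M} → M ∣ + N → a ≋ b → M ∣ b → M ∣ a
  ∣-resp-≋ {a} {b} {M} M∣N a≋b M∣b =
    subst (M ∣_) (identity a b) (∣m∣n⇒∣m+n (∣-trans M∣N (∣-diff a≋b)) M∣b)
    where identity : ∀ a b → (a - b) + b ≡ a
          identity = solve-∀

module _ {R S : RawRing 0ℓ 0ℓ} {k : ℕ} where
  private
    module R = RawRing R
    module S = RawRing S
    module R[X] = PolyOver R k
    module S[X] = PolyOver S k

  coeff-map₁ : (φ : R.Carrier → S.Carrier) → φ R.0# ≡ S.0# →
               (∀ a b → φ (a R.+ b) ≡ φ a S.+ φ b) →
               ∀ p m → S[X].coeff (map (map₁ φ) p) m ≡ φ (R[X].coeff p m)
  coeff-map₁ φ φ-0 φ-+ []             m = sym φ-0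
  coeff-map₁ φ φ-0 φ-+ ((a , m′) ∷ p) m with m′ ≟ₘ m
  ... | yes _ = trans (cong (φ a S.+_) (coeff-map₁ φ φ-0 φ-+ p m)) (sym (φ-+ a _))
  ... | no  _ = coeff-map₁ φ φ-0 φ-+ p m

module Polynomials (d k : ℕ) where
  open PolyOver (Zmod d) k
  open Congruence (2 ℕ.^ d)

  private variable
    e m : Mon k
    f g p q : Poly
    F G : List Poly

  coeff-++ : ∀ p q m → coeff (p ++ q) m ≡ coeff p m + coeff q m
  coeff-++ []             q m = sym (ℤ.+-identityˡ _)
  coeff-++ ((a , m′) ∷ p) q m with m′ ≟ₘ m
  ... | yes _ = trans (cong (_+_ a) (coeff-++ p q m)) (sym (ℤ.+-assoc a _ _))
  ... | no  _ = coeff-++ p q m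

  coeff-neg : ∀ p m → coeff (-ₚ p) m ≡ - coeff p m
  coeff-neg = coeff-map₁ -_ refl ℤ.neg-distrib-+

  coeff-sub : ∀ p q m → coeff (p -ₚ q) m ≡ coeff p m - coeff q m
  coeff-sub p q m = trans (coeff-++ p (-ₚ q) m) (cong (_+_ (coeff p m)) (coeff-neg q m))

  infix 4 _≋ₚ_
  record _≋ₚ_ (p q : Poly) : Set where
    constructor pointwise
    field coeff-≋ : ∀ m → coeff p m ≋ coeff q m
  open _≋ₚ_ public

  ≈ₚ⇒≋ₚ : p ≈ₚ q → p ≋ₚ q
  ≈ₚ⇒≋ₚ p≈q = pointwise (∣⇒≋ ∘ p≈q)

  ≋ₚ⇒≈ₚ : p ≋ₚ q → p ≈ₚ q
  ≋ₚ⇒≈ₚ p≋q = ≋⇒∣ ∘ coeff-≋ p≋q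

  ≋ₚ-reflexive : p ≡ q → p ≋ₚ q
  ≋ₚ-reflexive refl = pointwise λ _ → ≋-refl

  ≋ₚ-sym : p ≋ₚ q → q ≋ₚ p
  ≋ₚ-sym p≋q = pointwise (≋-sym ∘ coeff-≋ p≋q)

  ≋ₚ-trans : f ≋ₚ g → g ≋ₚ p → f ≋ₚ p
  ≋ₚ-trans f≋g g≋p = pointwise λ m → ≋-trans (coeff-≋ f≋g m) (coeff-≋ g≋p m)

  +ₚ-cong : f ≋ₚ g → p ≋ₚ q → f +ₚ p ≋ₚ g +ₚ q
  +ₚ-cong {f} {g} {p} {q} f≋g p≋q = pointwise λ m → begin
    coeff (f +ₚ p) m        ≡⟨ coeff-++ f p m ⟩
    coeff f m + coeff p m   ≈⟨ +-cong (coeff-≋ f≋g m) (coeff-≋ p≋q m) ⟩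
    coeff g m + coeff q m   ≡⟨ coeff-++ g q m ⟨
    coeff (g +ₚ q) m        ∎
    where open ≋-Reasoning

  -ₚ-identityʳ : p ≋ₚ 0ₚ → f -ₚ p ≋ₚ f
  -ₚ-identityʳ {p} {f} p≋0 = pointwise λ m → begin
    coeff (f -ₚ p) m        ≡⟨ coeff-sub f p m ⟩
    coeff f m - coeff p m   ≈⟨ +-cong (≋-refl {coeff f m}) (-‿cong (coeff-≋ p≋0 m)) ⟩
    coeff f m + + 0         ≡⟨ ℤ.+-identityʳ _ ⟩
    coeff f m               ∎
    where open ≋-Reasoning

  without : Mon k → Poly → Poly
  without e = filter (λ t → ¬? (proj₂ t ≟ₘ e))

  coeff-without-≡ : ∀ e r → coeff (without e r) e ≡ + 0
  coeff-without-≡ e []            = refl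
  coeff-without-≡ e ((a , x) ∷ r) with x ≟ₘ e
  ... | yes _ = coeff-without-≡ e r
  ... | no x≢e with x ≟ₘ e
  ...   | yes x≡e = contradiction x≡e x≢e
  ...   | no  _   = coeff-without-≡ e r

  coeff-without-≢ : ∀ r → m ≢ e → coeff (without e r) m ≡ coeff r m
  coeff-without-≢ []            _   = refl
  coeff-without-≢ {m} {e} ((a , x) ∷ r) m≢e with x ≟ₘ e
  ... | yes refl with x ≟ₘ m
  ...   | yes refl = contradiction refl m≢e
  ...   | no  _    = coeff-without-≢ r m≢e
  coeff-without-≢ {m} {e} ((a , x) ∷ r) m≢e | no _ with x ≟ₘ m
  ...   | yes _ = cong (_+_ a) (coeff-without-≢ r m≢e)
  ...   | no  _ = coeff-without-≢ r m≢e

  without-≋ₚ0 : ∀ e → p ≋ₚ 0ₚ → without e p ≋ₚ 0ₚ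
  without-≋ₚ0 {p} e p≋0 = pointwise coeff≋0
    where
      coeff≋0 : ∀ m → coeff (without e p) m ≋ + 0
      coeff≋0 m with m ≟ₘ e
      ... | yes refl = ≋-reflexive (coeff-without-≡ m p)
      ... | no m≢e   = ≋-trans (≋-reflexive (coeff-without-≢ p m≢e)) (coeff-≋ p≋0 m)

  length-without : ∀ a x r → length (without x ((a , x) ∷ r)) ℕ.< length ((a , x) ∷ r)
  length-without a x r with x ≟ₘ x
  ... | yes _   = ℕ.s≤s (length-filter _ r)
  ... | no x≢x = contradiction refl x≢x

  eval : (Mon k → ℤ) → Poly → ℤ
  eval w p = foldr _+_ (+ 0) (map (λ t → proj₁ t * w (proj₂ t)) p)

  module _ (w : Mon k → ℤ) where

    eval-++ : ∀ p q → eval w (p ++ q) ≡ eval w p + eval w q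
    eval-++ []            q = sym (ℤ.+-identityˡ _)
    eval-++ ((a , x) ∷ p) q =
      trans (cong (_+_ (a * w x)) (eval-++ p q)) (sym (ℤ.+-assoc (a * w x) (eval w p) (eval w q)))

    eval-neg : ∀ p → eval w (-ₚ p) ≡ - eval w p
    eval-neg []            = refl
    eval-neg ((a , x) ∷ p) = trans (cong₂ _+_ (sym (ℤ.neg-distribˡ-* a (w x))) (eval-neg p))
                                 (sym (ℤ.neg-distrib-+ (a * w x) (eval w p)))

    eval-without : ∀ e r → eval w r ≡ coeff r e * w e + eval w (without e r)
    eval-without e []            = refl
    eval-without e ((a , x) ∷ r) with x ≟ₘ e
    ... | yes refl = trans (cong (_+_ (a * w x)) (eval-without x r))
                           (identity a (coeff r x) (w x) (eval w (without x r)))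
      where identity : ∀ a c u v → a * u + (c * u + v) ≡ (a + c) * u + v
            identity = solve-∀
    ... | no  _    = trans (cong (_+_ (a * w x)) (eval-without e r))
                           (identity (a * w x) (coeff r e * w e) (eval w (without e r)))
      where identity : ∀ a b c → a + (b + c) ≡ b + (a + c)
            identity = solve-∀

    -- Terms of r may share a monomial: dropping all terms with the monomial x of the head
    -- changes the sum by coeff r x * w x ≋ 0.
    eval-≋0 : ∀ r → Acc ℕ._<_ (length r) → r ≋ₚ 0ₚ → eval w r ≋ + 0
    eval-≋0 []               _             _   = ≋-refl
    eval-≋0 r@((a , x) ∷ r′) (acc shorter) r≋0 = begin
      eval w r                                ≡⟨ eval-without x r ⟩
      coeff r x * w x + eval w (without x r)  ≈⟨ +-cong (*-cong (coeff-≋ r≋0 x) ≋-refl) rest≋0 ⟩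
      + 0 * w x + + 0                         ≡⟨⟩
      + 0                                     ∎
      where
        open ≋-Reasoning
        rest≋0 : eval w (without x r) ≋ + 0
        rest≋0 = eval-≋0 (without x r) (shorter (length-without a x r′)) (without-≋ₚ0 x r≋0)

    eval-cong : p ≋ₚ q → eval w p ≋ eval w q
    eval-cong {p} {q} p≋q = -≋0⇒≋ (begin
      eval w p - eval w q        ≡⟨ cong (_+_ (eval w p)) (eval-neg q) ⟨
      eval w p + eval w (-ₚ q)   ≡⟨ eval-++ p (-ₚ q) ⟨
      eval w (p -ₚ q)            ≈⟨ eval-≋0 (p -ₚ q) (<-wellFounded _) p-q≋0 ⟩
      + 0                        ∎)
      where
        open ≋-Reasoning
        p-q≋0 : p -ₚ q ≋ₚ 0ₚ
        p-q≋0 = pointwise λ m → ≋-trans (≋-reflexive (coeff-sub p q m)) (≋⇒-≋0 (coeff-≋ p≋q m))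

  eval-*ₚ-term : ∀ w p b → eval w (p *ₚ term b one) ≡ eval w p * b
  eval-*ₚ-term w []            b = refl
  eval-*ₚ-term w ((c , x) ∷ p) b =
    trans (cong₂ (λ y v → c * b * w y + v) (·ₘ-identityʳ x) (eval-*ₚ-term w p b))
          (identity c b (w x) (eval w p))
    where identity : ∀ c b u v → c * b * u + v * b ≡ (c * u + v) * b
          identity = solve-∀

  δ : Mon k → Mon k → ℤ
  δ x m with x ≟ₘ m
  ... | yes _ = + 1
  ... | no  _ = + 0

  scale : ℤ → Mon k → Poly → Poly
  scale a e = map (Product.map (a *_) (e ·ₘ_))

  -- A coefficient of scale a e q is a weighted evaluation of q, so scale-cong is an instance of
  -- eval-cong.
  coeff-scale : ∀ a e q m → coeff (scale a e q) m ≡ a * eval (λ x → δ (e ·ₘ x) m) q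
  coeff-scale a e []            m = sym (ℤ.*-zeroʳ a)
  coeff-scale a e ((b , y) ∷ q) m with e ·ₘ y ≟ₘ m
  ... | yes _ = trans (cong (_+_ (a * b)) (coeff-scale a e q m)) (identity a b _)
    where identity : ∀ a b v → a * b + a * v ≡ a * (b * + 1 + v)
          identity = solve-∀
  ... | no  _ = trans (coeff-scale a e q m) (identity a b _)
    where identity : ∀ a b v → a * v ≡ a * (b * + 0 + v)
          identity = solve-∀

  scale-cong : ∀ a e → p ≋ₚ q → scale a e p ≋ₚ scale a e q
  scale-cong {p} {q} a e p≋q = pointwise λ m → begin
    coeff (scale a e p) m   ≡⟨ coeff-scale a e p m ⟩
    a * eval (w m) p        ≈⟨ *-cong (≋-refl {a}) (eval-cong (w m) p≋q) ⟩
    a * eval (w m) q        ≡⟨ coeff-scale a e q m ⟨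
    coeff (scale a e q) m   ∎
    where
      open ≋-Reasoning
      w : Mon k → Mon k → ℤ
      w m x = δ (e ·ₘ x) m

  scale-scale : ∀ a e b y q → scale a e (scale b y q) ≡ scale (a * b) (e ·ₘ y) q
  scale-scale a e b y q = trans (sym (map-∘ q)) (map-cong (λ t →
    cong₂ _,_ (sym (ℤ.*-assoc a b (proj₁ t))) (sym (·ₘ-assoc e y (proj₂ t)))) q)

  scale-*ₚ : ∀ a e p q → scale a e (p *ₚ q) ≡ scale a e p *ₚ q
  scale-*ₚ a e []            q = refl
  scale-*ₚ a e ((b , y) ∷ p) q = trans (map-++ _ (scale b y q) (p *ₚ q))
    (cong₂ _++_ (scale-scale a e b y q) (scale-*ₚ a e p q))

  scale-identity : ∀ q → scale (+ 1) one q ≡ q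
  scale-identity q = trans (map-cong (λ t →
    cong₂ _,_ (ℤ.*-identityˡ (proj₁ t)) (·ₘ-identityˡ (proj₂ t))) q) (map-id q)

  -ₚ-as-scale : ∀ q → -ₚ q ≡ scale (- + 1) one q
  -ₚ-as-scale q = map-cong (λ t →
    cong₂ _,_ (sym (ℤ.-1*i≡-i (proj₁ t))) (sym (·ₘ-identityˡ (proj₂ t)))) q

  linearCombination : List (Poly × Poly) → Poly
  linearCombination hs = sumₚ (map (λ hg → proj₁ hg *ₚ proj₂ hg) hs)

  linearCombination-++ : ∀ hs hs′ →
    linearCombination hs +ₚ linearCombination hs′ ≡ linearCombination (hs ++ hs′)
  linearCombination-++ hs hs′ =
    trans (concat-++ (map _ hs) (map _ hs′)) (cong concat (sym (map-++ _ hs hs′)))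

  scale-linearCombination : ∀ a e hs →
    scale a e (linearCombination hs) ≡ linearCombination (map (map₁ (scale a e)) hs)
  scale-linearCombination a e []             = refl
  scale-linearCombination a e ((h , g) ∷ hs) = trans (map-++ _ (h *ₚ g) (linearCombination hs))
    (cong₂ _++_ (scale-*ₚ a e h g) (scale-linearCombination a e hs))

  infix 4 _∈⟨_⟩
  record _∈⟨_⟩ (f : Poly) (F : List Poly) : Set where
    constructor combination
    field
      cofactors  : List (Poly × Poly)
      generators : All (λ hg → proj₂ hg ∈ F) cofactors
      expansion  : f ≋ₚ linearCombination cofactors

  InIdeal⇒∈⟨⟩ : InIdeal F f → f ∈⟨ F ⟩
  InIdeal⇒∈⟨⟩ (hs , hs⊆F , f≈) = combination hs hs⊆F (≈ₚ⇒≋ₚ f≈)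

  ∈⟨⟩⇒InIdeal : f ∈⟨ F ⟩ → InIdeal F f
  ∈⟨⟩⇒InIdeal (combination hs hs⊆F f≋) = hs , hs⊆F , ≋ₚ⇒≈ₚ f≋

  ∈⟨⟩-resp-≋ₚ : f ≋ₚ g → f ∈⟨ F ⟩ → g ∈⟨ F ⟩
  ∈⟨⟩-resp-≋ₚ f≋g (combination hs hs⊆F f≋) = combination hs hs⊆F (≋ₚ-trans (≋ₚ-sym f≋g) f≋)

  ∈⟨⟩-0ₚ : 0ₚ ∈⟨ F ⟩
  ∈⟨⟩-0ₚ = combination [] [] (≋ₚ-reflexive refl)

  ∈⟨⟩-generator : g ∈ F → g ∈⟨ F ⟩
  ∈⟨⟩-generator {g} g∈F = combination ((term (+ 1) one , g) ∷ []) (g∈F ∷ []) (≋ₚ-reflexive g≡)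
    where
      g≡ : g ≡ linearCombination ((term (+ 1) one , g) ∷ [])
      g≡ = sym (trans (++-identityʳ _) (trans (++-identityʳ _) (scale-identity g)))

  ∈⟨⟩-+ₚ : f ∈⟨ F ⟩ → g ∈⟨ F ⟩ → f +ₚ g ∈⟨ F ⟩
  ∈⟨⟩-+ₚ (combination hs hs⊆F f≋) (combination hs′ hs′⊆F g≋) =
    combination (hs ++ hs′) (All.++⁺ hs⊆F hs′⊆F)
      (≋ₚ-trans (+ₚ-cong f≋ g≋) (≋ₚ-reflexive (linearCombination-++ hs hs′)))

  ∈⟨⟩-scale : ∀ a e → g ∈⟨ F ⟩ → scale a e g ∈⟨ F ⟩
  ∈⟨⟩-scale a e (combination hs hs⊆F g≋) =
    combination (map (map₁ (scale a e)) hs) (All.map⁺ hs⊆F)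
      (≋ₚ-trans (scale-cong a e g≋) (≋ₚ-reflexive (scale-linearCombination a e hs)))

  ∈⟨⟩-*ₚ : ∀ p → g ∈⟨ F ⟩ → p *ₚ g ∈⟨ F ⟩
  ∈⟨⟩-*ₚ []            _   = ∈⟨⟩-0ₚ
  ∈⟨⟩-*ₚ ((a , e) ∷ p) g∈ = ∈⟨⟩-+ₚ (∈⟨⟩-scale a e g∈) (∈⟨⟩-*ₚ p g∈)

  ∈⟨⟩-neg : g ∈⟨ F ⟩ → -ₚ g ∈⟨ F ⟩
  ∈⟨⟩-neg {g} {F} g∈ = subst (_∈⟨ F ⟩) (sym (-ₚ-as-scale g)) (∈⟨⟩-scale (- + 1) one g∈)

  ∈⟨⟩-sumₚ : ∀ {ps} → All (_∈⟨ F ⟩) ps → sumₚ ps ∈⟨ F ⟩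
  ∈⟨⟩-sumₚ []          = ∈⟨⟩-0ₚ
  ∈⟨⟩-sumₚ (p∈ ∷ ps∈) = ∈⟨⟩-+ₚ p∈ (∈⟨⟩-sumₚ ps∈)

  ∈⟨⟩-trans : All (_∈⟨ F ⟩) G → f ∈⟨ G ⟩ → f ∈⟨ F ⟩
  ∈⟨⟩-trans G⊆⟨F⟩ (combination hs hs⊆G f≋) = ∈⟨⟩-resp-≋ₚ (≋ₚ-sym f≋)
    (∈⟨⟩-sumₚ (All.map⁺ (All.map (λ {hg} g∈G → ∈⟨⟩-*ₚ (proj₁ hg) (All.lookup G⊆⟨F⟩ g∈G)) hs⊆G)))

module Specialisation (d n m : ℕ) (λ̄ : Vec ℤ m) where
  open Setting d n m
  open Polynomials d (n ℕ.+ n)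
  private module 𝓛 = Polynomials d m
  open Congruence (2 ℕ.^ d)

  coeff-substλ : ∀ P mo → ZX.coeff (substλ λ̄ P) mo ≡ evalL λ̄ (LX.coeff P mo)
  coeff-substλ = coeff-map₁ {R = LR} {S = ZR} (evalL λ̄) refl (𝓛.eval-++ (evalMon λ̄))

  substλ-cong : ∀ {P Q} → P LX.≈ₚ Q → substλ λ̄ P ≋ₚ substλ λ̄ Q
  substλ-cong {P} {Q} P≈Q = pointwise λ mo → begin
    ZX.coeff (substλ λ̄ P) mo   ≡⟨ coeff-substλ P mo ⟩
    evalL λ̄ (LX.coeff P mo)    ≈⟨ 𝓛.eval-cong (evalMon λ̄) (coeff-≈ mo) ⟩
    evalL λ̄ (LX.coeff Q mo)    ≡⟨ coeff-substλ Q mo ⟨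
    ZX.coeff (substλ λ̄ Q) mo   ∎
    where
      open ≋-Reasoning
      coeff-≈ : ∀ mo → LX.coeff P mo 𝓛.≋ₚ LX.coeff Q mo
      coeff-≈ mo = 𝓛.≈ₚ⇒≋ₚ (P≈Q mo)

  substλ-+ₚ : ∀ P Q → substλ λ̄ (P LX.+ₚ Q) ≡ substλ λ̄ P ZX.+ₚ substλ λ̄ Q
  substλ-+ₚ = map-++ _

  substλ-neg : ∀ P → substλ λ̄ (LX.-ₚ P) ≡ ZX.-ₚ substλ λ̄ P
  substλ-neg P = trans (sym (map-∘ P))
    (trans (map-cong (λ t → cong (_, proj₂ t) (𝓛.eval-neg (evalMon λ̄) (proj₁ t))) P) (map-∘ P))

  substλ-scale-embed : ∀ a e g →
    substλ λ̄ (map (λ t → (a L.*ₚ proj₁ t , e ·ₘ proj₂ t)) (embed g)) ≡ scale (evalL λ̄ a) e g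
  substλ-scale-embed a e []            = refl
  substλ-scale-embed a e ((b , y) ∷ g) =
    cong₂ _∷_ (cong (_, e ·ₘ y) (𝓛.eval-*ₚ-term (evalMon λ̄) a b)) (substλ-scale-embed a e g)

  substλ-*ₚ-embed : ∀ H g → substλ λ̄ (H LX.*ₚ embed g) ≡ substλ λ̄ H ZX.*ₚ g
  substλ-*ₚ-embed []            g = refl
  substλ-*ₚ-embed ((a , e) ∷ H) g = trans (substλ-+ₚ (map _ (embed g)) (H LX.*ₚ embed g))
    (cong₂ _++_ (substλ-scale-embed a e g) (substλ-*ₚ-embed H g))

  substλ-linearCombination-∈⟨⟩ : ∀ {G} hs → All (λ hg → proj₂ hg ∈ map embed G) hs →
    substλ λ̄ (LX.sumₚ (map (λ hg → proj₁ hg LX.*ₚ proj₂ hg) hs)) ∈⟨ G ⟩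
  substλ-linearCombination-∈⟨⟩     []             []           = ∈⟨⟩-0ₚ
  substλ-linearCombination-∈⟨⟩ {G} ((H , _) ∷ hs) (g′∈ ∷ hs⊆) with ∈-map⁻ embed g′∈
  ... | g , g∈G , refl = subst (_∈⟨ G ⟩) (sym (substλ-+ₚ (H LX.*ₚ embed g) _))
                           (∈⟨⟩-+ₚ S[Hg]∈ (substλ-linearCombination-∈⟨⟩ hs hs⊆))
    where
      S[Hg]∈ : substλ λ̄ (H LX.*ₚ embed g) ∈⟨ G ⟩
      S[Hg]∈ = subst (_∈⟨ G ⟩) (sym (substλ-*ₚ-embed H g))
                     (∈⟨⟩-*ₚ (substλ λ̄ H) (∈⟨⟩-generator g∈G))

  substλ-∈⟨⟩ : ∀ {G P} → LX.InIdeal (map embed G) P → substλ λ̄ P ∈⟨ G ⟩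
  substλ-∈⟨⟩ {P = P} (hs , hs⊆ , P≈) =
    ∈⟨⟩-resp-≋ₚ (≋ₚ-sym (substλ-cong {P} P≈)) (substλ-linearCombination-∈⟨⟩ hs hs⊆)

  vanishing-remainder⇒substλ-∈⟨⟩ : ∀ {G} f P → LX.InIdeal (map embed G) (f LX.-ₚ P) →
    substλ λ̄ P ZX.≈ₚ ZX.0ₚ → substλ λ̄ f ∈⟨ G ⟩
  vanishing-remainder⇒substλ-∈⟨⟩ {G} f P f-P∈ P̄≈0 =
    ∈⟨⟩-resp-≋ₚ (-ₚ-identityʳ (≈ₚ⇒≋ₚ P̄≈0)) (subst (_∈⟨ G ⟩) f-P̄≡ (substλ-∈⟨⟩ f-P∈))
    where
      f-P̄≡ : substλ λ̄ (f LX.-ₚ P) ≡ substλ λ̄ f ZX.-ₚ substλ λ̄ P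
      f-P̄≡ = trans (substλ-+ₚ f (LX.-ₚ P)) (cong (substλ λ̄ f ++_) (substλ-neg P))

module NormalForms (d n m : ℕ) (_≺_ : Rel (Mon (n ℕ.+ n)) 0ℓ) where
  open Setting d n m
  open WithOrder _≺_
  open Polynomials d (n ℕ.+ n)
  open Congruence (2 ℕ.^ d)
  open RawRing ZR using () renaming (_≈_ to _≈ᶻ_)
  open ZX.Ordered _≺_ using (IsLT)

  private variable
    a : ℤ
    j : ℕ
    f h : ZX.Poly
    G : List ZX.Poly

  2^ : ℕ → ℤ
  2^ j = + (2 ℕ.^ j)

  2^-mono-∣ : ∀ {i j} → i ≤ j → 2^ i ∣ 2^ j
  2^-mono-∣ {i} {j} i≤j = ∣ᵤ⇒∣ {2^ i} {2^ j} (^-monoʳ-∣ 2 i≤j)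

  Divides2^⇒∣ : j ≤ d → Divides2^ j a → 2^ j ∣ a
  Divides2^⇒∣ {j} j≤d (b , a≈) =
    ∣-resp-≋ (2^-mono-∣ j≤d) (∣⇒≋ a≈) (∣m⇒∣m*n b (∣-refl {2^ j}))

  ∣⇒Divides2^ : ∀ j → 2^ j ∣ a → Divides2^ j a
  ∣⇒Divides2^ j (divides q a≡q2ʲ) = q , ≋⇒∣ (≋-reflexive (trans a≡q2ʲ (ℤ.*-comm q (2^ j))))

  Divides2^-≥d : ∀ a → d ≤ j → Divides2^ j a → a ≋ + 0
  Divides2^-≥d a d≤j (b , a≈) = ≋-trans (∣⇒≋ a≈) (∣⇒≋0 (∣m⇒∣m*n b (2^-mono-∣ d≤j)))

  Divides2^? : ∀ a → j ℕ.< d → Dec (Divides2^ j a)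
  Divides2^? {j} a j<d = map′ (∣⇒Divides2^ j) (Divides2^⇒∣ (ℕ.<⇒≤ j<d)) (2^ j ∣? a)

  Divides2^-bounded : ∀ a → ¬ (a ≈ᶻ + 0) → Divides2^ j a → j ℕ.< d
  Divides2^-bounded a a≉0 Dj = ℕ.≰⇒> λ d≤j → a≉0 (≋⇒∣ (Divides2^-≥d a d≤j Dj))

  valuation : ∀ a → ¬ (a ≈ᶻ + 0) → ∃ (IsVal a)
  valuation a a≉0 = map₂ (a≉0 ,_) (greatest d (Divides2^? a) (Divides2^-bounded a a≉0) 2⁰∣a)
    where
      2⁰∣a : Divides2^ 0 a
      2⁰∣a = ∣⇒Divides2^ 0 (divides a (sym (ℤ.*-identityʳ a)))

  lc≉0 : ∀ {p a mo} → IsLT p a mo → ¬ (a ≈ᶻ + 0)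
  lc≉0 {p} {a} {mo} ((p[mo]≉0 , _) , a≈p[mo]) a≈0 = p[mo]≉0 (≋⇒∣ (begin
    ZX.coeff p mo   ≈⟨ ∣⇒≋ a≈p[mo] ⟨
    a               ≈⟨ ∣⇒≋ a≈0 ⟩
    + 0             ∎))
    where open ≋-Reasoning

  Divides2^-multiple : ∀ {j a} c a′ → a ≋ c * a′ → Divides2^ j a′ → Divides2^ j a
  Divides2^-multiple {j} {a} c a′ a≋ca′ (b , a′≈) = c * b , ≋⇒∣ (begin
    a                ≈⟨ a≋ca′ ⟩
    c * a′           ≈⟨ *-cong (≋-refl {c}) (∣⇒≋ a′≈) ⟩
    c * (2^ j * b)   ≡⟨ identity c (2^ j) b ⟩
    2^ j * (c * b)   ∎)
    where
      open ≋-Reasoning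
      identity : ∀ c t b → c * (t * b) ≡ t * (c * b)
      identity = solve-∀

  StrongRed⇒NFReducible : ∀ {h′} → StrongRed G h h′ → NFReducible G h
  StrongRed⇒NFReducible {h = h}
    (g , c , r , lcf , lmf , lcg , lmg , g∈G , ((h[lmf]≉0 , _) , lcf≈) , ltg , lmf≡ , lcf≈c*lcg , _)
    with vt , val-t@(_ , _ , maximal) ← valuation (ZX.coeff h lmf) h[lmf]≉0
       | vg , val-g@(_ , 2^vg∣lcg , _) ← valuation lcg (lc≉0 {g} {lcg} {lmg} ltg)
    = g , lmf , lcg , lmg , vt , vg , g∈G , ltg , val-t , val-g ,
      maximal vg (Divides2^-multiple {vg} c lcg h[lmf]≋c*lcg 2^vg∣lcg) , (r , lmf≡)
    where
      h[lmf]≋c*lcg : ZX.coeff h lmf ≋ c * lcg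
      h[lmf]≋c*lcg = begin
        ZX.coeff h lmf   ≈⟨ ∣⇒≋ lcf≈ ⟨
        lcf              ≈⟨ ∣⇒≋ lcf≈c*lcg ⟩
        c * lcg          ∎
        where open ≋-Reasoning

  irreducible⇒≈0 : ¬ NFReducible G h → ReducesToZero G h → h ZX.≈ₚ ZX.0ₚ
  irreducible⇒≈0         _           (_ , ε , h≈0)                    = h≈0
  irreducible⇒≈0 {G} {h} irreducible (_ , _◅_ {j = h₁} step _ , _) =
    contradiction (StrongRed⇒NFReducible {G} {h} {h₁} step) irreducible

  NFStep-∈⟨⟩ : ∀ {f′} → NFStep G f f′ → f ∈⟨ G ⟩ → f′ ∈⟨ G ⟩
  NFStep-∈⟨⟩ (g , _ , _ , _ , _ , _ , r , q , g∈G , _ , _ , _ , _ , _ , _ , f′≈) f∈ =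
    ∈⟨⟩-resp-≋ₚ (≋ₚ-sym (≈ₚ⇒≋ₚ f′≈)) (∈⟨⟩-+ₚ f∈ (∈⟨⟩-neg (∈⟨⟩-*ₚ (ZX.term q r) (∈⟨⟩-generator g∈G))))

  NFSteps-∈⟨⟩ : Star (NFStep G) f h → f ∈⟨ G ⟩ → h ∈⟨ G ⟩
  NFSteps-∈⟨⟩ {G} = fold (λ f h → f ∈⟨ G ⟩ → h ∈⟨ G ⟩) (λ step rest → rest ∘ NFStep-∈⟨⟩ step) id

proposition5 : (d n m : ℕ) → 1 ≤ d →
  (_≺_ : Rel (Mon (n Data.Nat.+ n)) 0ℓ) → IsMonomialOrder _≺_ →
  (qs : Vec (Mon n) m) → (∀ i j → lookup qs i ≡ lookup qs j → i ≡ j) →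
  (F G : List (Setting.ZX.Poly d n m)) →
  Setting.WithOrder.IsStrongGB d n m _≺_ F G →
  (PNF : Setting.LX.Poly d n m → List (Setting.ZX.Poly d n m) → Setting.LX.Poly d n m) →
  Setting.WithOrder.IsPNF d n m _≺_ PNF →
  (μ : ℤ) → (λ̄ : Vec ℤ m) →
  let open Setting d n m
      f = η′ qs LX.-ₚ (LX.term (constL μ) one LX.*ₚ η qs)
  in Setting.ZX._≈ₚ_ d n m (substλ λ̄ (PNF f G)) ZX.0ₚ →
     ∀ h → Setting.WithOrder.IsNF d n m _≺_ G (substλ λ̄ f) h →
     h ZX.≈ₚ ZX.0ₚ
proposition5 d n m _ _≺_ _ qs _ F G (G⊆⟨F⟩ , ⟨F⟩⇔↠0) PNF isPNF μ λ̄ PNF̄≈0 h (steps , irreducible) =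
  irreducible⇒≈0 irreducible (Equivalence.to (⟨F⟩⇔↠0 h) (∈⟨⟩⇒InIdeal h∈⟨F⟩))
  where
    open Setting d n m
    open Polynomials d (n ℕ.+ n)
    open Specialisation d n m λ̄
    open NormalForms d n m _≺_

    f : LX.Poly
    f = η′ qs LX.-ₚ (LX.term (constL μ) one LX.*ₚ η qs)

    f̄∈⟨G⟩ : substλ λ̄ f ∈⟨ G ⟩
    f̄∈⟨G⟩ = vanishing-remainder⇒substλ-∈⟨⟩ f (PNF f G) (WithOrder.IsPNF.pnf-ideal isPNF f G) PNF̄≈0

    h∈⟨F⟩ : h ∈⟨ F ⟩
    h∈⟨F⟩ = ∈⟨⟩-trans (All.map InIdeal⇒∈⟨⟩ G⊆⟨F⟩) (NFSteps-∈⟨⟩ steps f̄∈⟨G⟩)
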